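{- For every integer $n\geq 3$, the number of Fishburn permutations $\pi=\pi_1\cdots\pi_n$ of length $n$ that avoid both $321$ and $1324$ and satisfy $\pi_2=1$ equals $\frac{3}{2}n^{2}-\frac{15}{2}n+11$.
   Context: A permutation of length $n$ is a rearrangement $\pi=\pi_1\cdots\pi_n$ of $[n]$. A permutation $\pi$ contains a classical pattern $p\in S_k$ if some subsequence of $\pi$ of length $k$ is order-isomorphic to $p$; otherwise it avoids $p$. A Fishburn permutation is a permutation $\pi$ for which there are no indices $i<j$ with $\pi_j<\pi_i<\pi_{i+1}$ and $\pi_i=\pi_j+1$. -}

module Defs where

open import Data.Nat using (ℕ; zero; suc; _+_; _*_; _∸_; _≤_; _<_)
open import Data.Fin using (Fin; toℕ)
open import Data.Vec using (Vec; lookup)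
open import Data.Product using (Σ; ∃; _×_; _,_)
open import Data.List using (List; length)
open import Data.List.Membership.Propositional using (_∈_)
open import Data.List.Relation.Unary.Unique.Propositional using (Unique)
open import Function.Definitions using (Injective)
open import Relation.Binary.PropositionalEquality using (_≡_)
open import Relation.Nullary using (¬_)

-- A word of length n over [n] (0-based values: value k stands for k+1),
-- positions are Fin n (0-based: position i stands for i+1).
Word : ℕ → Set
Word n = Vec (Fin n) n

_!_ : ∀ {n} → Word n → Fin n → Fin n
π ! i = lookup π i

-- π is a permutation of [n]: the map position ↦ value is injective
-- (hence bijective, as Fin n is finite).
IsPerm : ∀ {n} → Word n → Set
IsPerm π = Injective _≡_ _≡_ (lookup π)

_<ᶠ_ : ∀ {n} → Fin n → Fin n → Set
a <ᶠ b = toℕ a < toℕ b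

Contains321 : ∀ {n} → Word n → Set
Contains321 {n} π = Σ (Fin n) λ i → Σ (Fin n) λ j → Σ (Fin n) λ k →
  (i <ᶠ j) × (j <ᶠ k) × ((π ! k) <ᶠ (π ! j)) × ((π ! j) <ᶠ (π ! i))

Contains1324 : ∀ {n} → Word n → Set
Contains1324 {n} π = Σ (Fin n) λ i → Σ (Fin n) λ j → Σ (Fin n) λ k → Σ (Fin n) λ l →
  (i <ᶠ j) × (j <ᶠ k) × (k <ᶠ l) ×
  ((π ! i) <ᶠ (π ! k)) × ((π ! k) <ᶠ (π ! j)) × ((π ! j) <ᶠ (π ! l))

-- Fishburn: no indices i<j with π_j < π_i < π_{i+1} and π_i = π_j + 1.
-- The position i+1 must exist, i.e. toℕ i + 1 < n; we quantify over
-- positions i and i' with toℕ i' ≡ suc (toℕ i).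
IsFishburn : ∀ {n} → Word n → Set
IsFishburn {n} π = ¬ (Σ (Fin n) λ i → Σ (Fin n) λ i' → Σ (Fin n) λ j →
  (toℕ i' ≡ suc (toℕ i)) × (i <ᶠ j) ×
  ((π ! j) <ᶠ (π ! i)) × ((π ! i) <ᶠ (π ! i')) × (toℕ (π ! i) ≡ suc (toℕ (π ! j))))

-- The set counted in Proposition 2.8 (for n ≥ 2, so that position 2 exists):
-- Fishburn permutations avoiding 321 and 1324 with π_2 = 1.
Counted : ∀ {n} → Word (suc (suc n)) → Set
Counted π = IsPerm π × IsFishburn π × ¬ Contains321 π × ¬ Contains1324 π
  × (toℕ (π ! Data.Fin.suc Data.Fin.zero) ≡ 0)

-- "The number of words satisfying P is c": there is a duplicate-free list
-- containing exactly the words satisfying P, and it has length c.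
HasCount : ∀ {m} → (Word m → Set) → ℕ → Set
HasCount {m} P c = Σ (List (Word m)) λ xs →
  Unique xs × (∀ π → (π ∈ xs → P π) × (P π → π ∈ xs)) × (length xs ≡ c)

-- Write a for the first entry and q for the position of the maximum n. The 1 in position 2
-- turns every 213 after it into a 1324, and 321-avoidance makes the entries after the maximum
-- ascend; so from position 3 on, the permutation is an ascending run up to the maximum followed
-- by an ascending run, and the Fishburn condition forbids an entry before the maximum to be one
-- more than an entry after it. What remains are three shapes: n 1 2 ⋯ (n-1) (one permutation);
-- all entries other than a, 1 and n in increasing order ((n-2)² choices of a and q); and
-- a 1 2 ⋯ j (a+1) ⋯ n (j+1) ⋯ (a-1), where the runs around the maximum lie on either side of a
-- ((n-3)(n-4)/2 choices of 1 ≤ j < a - 1 < n - 2). Each shape is counted, and a counted permutation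
-- agrees with the shape it matches: at the first position p where they differ, each of the two
-- values there occurs later in the other permutation, and this produces a forbidden pattern.
-- Hence there are (n-2)² + (n-3)(n-4)/2 + 1 of them.

module Submission where

open import Defs
open import Data.Empty using (⊥; ⊥-elim)
open import Data.Fin as Fin using (Fin; toℕ; fromℕ<; punchOut)
open import Data.Fin.Properties
  using (toℕ<n; toℕ-fromℕ<; fromℕ<-toℕ; toℕ-injective; pigeonhole; punchOut-injective; any?)
open import Data.List using (List; []; _∷_; _++_; map; length; upTo; cartesianProductWith)
open import Data.List.Membership.Propositional using (_∈_)
open import Data.List.Membership.Propositional.Properties
  using (∈-map⁺; ∈-map⁻; ∈-++⁺ˡ; ∈-++⁺ʳ; ∈-++⁻; ∈-upTo⁺; ∈-upTo⁻; ∈-cartesianProductWith⁺; ∈-cartesianProductWith⁻)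
open import Data.List.Properties using (length-++; length-map; length-upTo)
open import Data.List.Relation.Binary.Disjoint.Propositional using (Disjoint)
import Data.List.Relation.Unary.All as All
import Data.List.Relation.Unary.All.Properties as All
open import Data.List.Relation.Unary.AllPairs using ([]; _∷_)
open import Data.List.Relation.Unary.Any using (here; there)
open import Data.List.Relation.Unary.Unique.Propositional using (Unique)
import Data.List.Relation.Unary.Unique.Propositional.Properties as Unique
open import Data.Nat using (ℕ; zero; suc; pred; _+_; _*_; _∸_; _≤_; _<_; z≤n; s≤s; _<?_; _≤?_)
open import Data.Nat.Induction using (<-rec)
open import Data.Nat.Properties
open import Data.Nat.Tactic.RingSolver using (solve-∀)
open import Data.Product using (Σ; ∃; ∃₂; _×_; _,_; proj₁; proj₂)
open import Data.Sum using (_⊎_; inj₁; inj₂)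
open import Data.Unit using (⊤; tt)
open import Data.Vec using (tabulate)
open import Data.Vec.Properties using (lookup∘tabulate; tabulate∘lookup; tabulate-cong)
open import Function.Definitions using (Injective)
open import Relation.Binary.Definitions using (Tri; tri<; tri≈; tri>)
open import Relation.Binary.PropositionalEquality
open import Relation.Nullary using (¬_; yes; no)
open import Relation.Nullary.Decidable using (_×-dec_)

fin-injective⇒surjective : ∀ {n} (f : Fin n → Fin n) → Injective _≡_ _≡_ f → ∀ v → ∃ λ i → f i ≡ v
fin-injective⇒surjective {zero} f inj ()
fin-injective⇒surjective {suc n} f inj v with any? (λ i → f i Fin.≟ v)
... | yes hit = hit
... | no miss = ⊥-elim (no-collision (pigeonhole (n<1+n n) (λ i → punchOut (f≢v i))))
  where
  f≢v : ∀ i → v ≢ f i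
  f≢v i v≡fi = miss (i , sym v≡fi)
  no-collision : ∃₂ (λ i j → i Fin.< j × punchOut (f≢v i) ≡ punchOut (f≢v j)) → ⊥
  no-collision (i , j , i<j , eq) = <-irrefl (cong toℕ (inj (punchOut-injective (f≢v i) (f≢v j) eq))) i<j

<⇒≡suc : ∀ {m n} → m < n → ∃ λ z → n ≡ suc z × m ≤ z
<⇒≡suc (s≤s m≤z) = _ , refl , m≤z

injective-from-distinct : ∀ {n} {F : ℕ → ℕ} → (∀ {x y} → x < y → y < n → F x ≢ F y) →
                          ∀ {x y} → x < n → y < n → F x ≡ F y → x ≡ y
injective-from-distinct distinct {x} {y} x<n y<n Fx≡Fy with <-cmp x y
... | tri< x<y _ _ = ⊥-elim (distinct x<y y<n Fx≡Fy)
... | tri≈ _ x≡y _ = x≡y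
... | tri> _ _ y<x = ⊥-elim (distinct y<x x<n (sym Fx≡Fy))

agree-by-induction : ∀ {N} {P F : ℕ → ℕ} →
  (∀ p → p < N → (∀ r → r < p → P r ≡ F r) → P p ≡ F p) → ∀ {p} → p < N → P p ≡ F p
agree-by-induction {N} {P} {F} step {p} = <-rec (λ p → p < N → P p ≡ F p)
  (λ p rec p<N → step p p<N (λ r r<p → rec r<p (<-trans r<p p<N))) p

length-cartesianProductWith : ∀ {A B C : Set} (f : A → B → C) xs ys →
  length (cartesianProductWith f xs ys) ≡ length xs * length ys
length-cartesianProductWith f [] ys = refl
length-cartesianProductWith f (x ∷ xs) ys = begin
  length (map (f x) ys ++ cartesianProductWith f xs ys)  ≡⟨ length-++ (map (f x) ys) ⟩
  length (map (f x) ys) + length (cartesianProductWith f xs ys)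
    ≡⟨ cong₂ _+_ (length-map (f x) ys) (length-cartesianProductWith f xs ys) ⟩
  length ys + length xs * length ys  ∎
  where open ≡-Reasoning

map⁺-injectiveOn : ∀ {A B : Set} (f : A → B) {xs : List A} →
  (∀ {x y} → x ∈ xs → y ∈ xs → f x ≡ f y → x ≡ y) → Unique xs → Unique (map f xs)
map⁺-injectiveOn f {[]} _ [] = []
map⁺-injectiveOn f {x ∷ xs} inj (x∉xs ∷ xs!) =
  All.map⁺ (All.tabulate λ y∈xs fx≡fy → All.lookup x∉xs y∈xs (inj (here refl) (there y∈xs) fx≡fy))
  ∷ map⁺-injectiveOn f (λ x∈xs y∈xs → inj (there x∈xs) (there y∈xs)) xs!

-- Counted permutations as functions

record IsCountedFun (n : ℕ) (P : ℕ → ℕ) : Set where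
  field
    bounded    : ∀ {x} → x < n → P x < n
    injective  : ∀ {x y} → x < n → y < n → P x ≡ P y → x ≡ y
    avoids321  : ∀ {i j k} → i < j → j < k → k < n → P k < P j → P j < P i → ⊥
    avoids1324 : ∀ {i j k l} → i < j → j < k → k < l → l < n →
                 P i < P k → P k < P j → P j < P l → ⊥
    fishburn   : ∀ {i j} → i < j → j < n → suc i < n →
                 P j < P i → P i < P (suc i) → P i ≡ suc (P j) → ⊥
    second≡0   : P 1 ≡ 0

  surjective : ∀ {v} → v < n → ∃ λ x → x < n × P x ≡ v
  surjective {v} v<n with fin-injective⇒surjective f f-injective (fromℕ< v<n)
    where
    f : Fin n → Fin n
    f i = fromℕ< (bounded (toℕ<n i))
    f-injective : Injective _≡_ _≡_ f
    f-injective {i} {j} fi≡fj = toℕ-injective (injective (toℕ<n i) (toℕ<n j)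
      (trans (sym (toℕ-fromℕ< _)) (trans (cong toℕ fi≡fj) (toℕ-fromℕ< _))))
  ... | i , fi≡v = toℕ i , toℕ<n i , trans (sym (toℕ-fromℕ< _)) (trans (cong toℕ fi≡v) (toℕ-fromℕ< v<n))

valueAt : ∀ {n} → Word n → ℕ → ℕ
valueAt {n} π x with x <? n
... | yes x<n = toℕ (π ! fromℕ< x<n)
... | no _ = 0

valueAt-fromℕ< : ∀ {n} (π : Word n) {x} (x<n : x < n) → valueAt π x ≡ toℕ (π ! fromℕ< x<n)
valueAt-fromℕ< {n} π {x} x<n with x <? n
... | yes _ = refl
... | no x≮n = ⊥-elim (x≮n x<n)

valueAt-toℕ : ∀ {n} (π : Word n) (i : Fin n) → valueAt π (toℕ i) ≡ toℕ (π ! i)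
valueAt-toℕ π i = trans (valueAt-fromℕ< π (toℕ<n i)) (cong (λ j → toℕ (π ! j)) (fromℕ<-toℕ i (toℕ<n i)))

clamp : ∀ {n} → ℕ → Fin (suc n)
clamp {n} v with v <? suc n
... | yes v<n = fromℕ< v<n
... | no _ = Fin.zero

toℕ-clamp : ∀ {n v} → v < suc n → toℕ (clamp {n} v) ≡ v
toℕ-clamp {n} {v} v<n with v <? suc n
... | yes v<n′ = toℕ-fromℕ< v<n′
... | no v≮n = ⊥-elim (v≮n v<n)

wordOf : ∀ {n} → (ℕ → ℕ) → Word (suc n)
wordOf F = tabulate (λ i → clamp (F (toℕ i)))

module _ {n : ℕ} {F : ℕ → ℕ} (bounded : ∀ {x} → x < suc n → F x < suc n) where

  toℕ-wordOf : (i : Fin (suc n)) → toℕ (wordOf {n} F ! i) ≡ F (toℕ i)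
  toℕ-wordOf i = trans (cong toℕ (lookup∘tabulate (λ j → clamp {n} (F (toℕ j))) i))
                       (toℕ-clamp (bounded (toℕ<n i)))

  valueAt-wordOf : ∀ {x} → x < suc n → valueAt (wordOf {n} F) x ≡ F x
  valueAt-wordOf x<n = trans (valueAt-fromℕ< (wordOf F) x<n)
    (trans (toℕ-wordOf (fromℕ< x<n)) (cong F (toℕ-fromℕ< x<n)))

wordOf-valueAt : ∀ {n} (π : Word (suc n)) (F : ℕ → ℕ) →
                 (∀ {x} → x < suc n → valueAt π x ≡ F x) → π ≡ wordOf F
wordOf-valueAt π F π≗F = trans (sym (tabulate∘lookup π)) (tabulate-cong λ i → toℕ-injective (begin
  toℕ (π ! i)               ≡⟨ sym (valueAt-toℕ π i) ⟩
  valueAt π (toℕ i)         ≡⟨ π≗F (toℕ<n i) ⟩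
  F (toℕ i)                 ≡⟨ sym (toℕ-clamp (subst (_< _) (π≗F (toℕ<n i)) (valueAt<n i))) ⟩
  toℕ (clamp (F (toℕ i)))   ∎))
  where
  open ≡-Reasoning
  valueAt<n : ∀ i → valueAt π (toℕ i) < _
  valueAt<n i = subst (_< _) (sym (valueAt-toℕ π i)) (toℕ<n (π ! i))

module _ {m : ℕ} where

  private
    n : ℕ
    n = suc (suc m)

  counted⇒isCountedFun : (π : Word n) → Counted π → IsCountedFun n (valueAt π)
  counted⇒isCountedFun π (perm , fish , ¬321 , ¬1324 , π₂≡0) = record
    { bounded = λ x<n → subst (_< n) (sym (valueAt-fromℕ< π x<n)) (toℕ<n _)
    ; injective = λ x<n y<n eq → trans (sym (toℕ-fromℕ< x<n)) (trans (cong toℕ (perm (toℕ-injective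
        (trans (sym (valueAt-fromℕ< π x<n)) (trans eq (valueAt-fromℕ< π y<n)))))) (toℕ-fromℕ< y<n))
    ; avoids321 = λ i<j j<k k<n Pk<Pj Pj<Pi →
        let j<n = <-trans j<k k<n ; i<n = <-trans i<j j<n in
        ¬321 (fromℕ< i<n , fromℕ< j<n , fromℕ< k<n , pos i<n j<n i<j , pos j<n k<n j<k ,
              val k<n j<n Pk<Pj , val j<n i<n Pj<Pi)
    ; avoids1324 = λ i<j j<k k<l l<n Pi<Pk Pk<Pj Pj<Pl →
        let k<n = <-trans k<l l<n ; j<n = <-trans j<k k<n ; i<n = <-trans i<j j<n in
        ¬1324 (fromℕ< i<n , fromℕ< j<n , fromℕ< k<n , fromℕ< l<n ,
               pos i<n j<n i<j , pos j<n k<n j<k , pos k<n l<n k<l ,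
               val i<n k<n Pi<Pk , val k<n j<n Pk<Pj , val j<n l<n Pj<Pl)
    ; fishburn = λ i<j j<n i+1<n below rise adjacent →
        let i<n = <-trans i<j j<n in
        fish (fromℕ< i<n , fromℕ< i+1<n , fromℕ< j<n ,
              trans (toℕ-fromℕ< i+1<n) (cong suc (sym (toℕ-fromℕ< i<n))) , pos i<n j<n i<j ,
              val j<n i<n below , val i<n i+1<n rise ,
              trans (sym (valueAt-fromℕ< π i<n)) (trans adjacent (cong suc (valueAt-fromℕ< π j<n))))
    ; second≡0 = trans (valueAt-fromℕ< π (s≤s (s≤s z≤n))) π₂≡0
    }
    where
    pos : ∀ {x y} (x<n : x < n) (y<n : y < n) → x < y → fromℕ< x<n <ᶠ fromℕ< y<n
    pos x<n y<n = subst₂ _<_ (sym (toℕ-fromℕ< x<n)) (sym (toℕ-fromℕ< y<n))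
    val : ∀ {x y} (x<n : x < n) (y<n : y < n) → valueAt π x < valueAt π y →
          (π ! fromℕ< x<n) <ᶠ (π ! fromℕ< y<n)
    val x<n y<n = subst₂ _<_ (valueAt-fromℕ< π x<n) (valueAt-fromℕ< π y<n)

  isCountedFun⇒counted : (F : ℕ → ℕ) → IsCountedFun n F → Counted (wordOf {suc m} F)
  isCountedFun⇒counted F isC =
      (λ {i} {j} eq → toℕ-injective (injective (toℕ<n i) (toℕ<n j) (trans (sym (W i)) (trans (cong toℕ eq) (W j)))))
    , (λ (i , i′ , j , i′≡i+1 , i<j , below , rise , adjacent) →
         fishburn i<j (toℕ<n j) (subst (_< n) i′≡i+1 (toℕ<n i′))
           (subst₂ _<_ (W j) (W i) below)
           (subst₂ _<_ (W i) (trans (W i′) (cong F i′≡i+1)) rise)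
           (trans (sym (W i)) (trans adjacent (cong suc (W j)))))
    , (λ (i , j , k , i<j , j<k , πk<πj , πj<πi) →
         avoids321 i<j j<k (toℕ<n k) (subst₂ _<_ (W k) (W j) πk<πj) (subst₂ _<_ (W j) (W i) πj<πi))
    , (λ (i , j , k , l , i<j , j<k , k<l , πi<πk , πk<πj , πj<πl) →
         avoids1324 i<j j<k k<l (toℕ<n l)
           (subst₂ _<_ (W i) (W k) πi<πk) (subst₂ _<_ (W k) (W j) πk<πj) (subst₂ _<_ (W j) (W l) πj<πl))
    , trans (W (Fin.suc Fin.zero)) second≡0
    where
    open IsCountedFun isC
    W : (i : Fin n) → toℕ (wordOf {suc m} F ! i) ≡ F (toℕ i)
    W = toℕ-wordOf bounded

module CountedFunProperties {M : ℕ} {P : ℕ → ℕ} (isC : IsCountedFun (suc M) P) where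
  open IsCountedFun isC

  value≤max : ∀ {x} → x < suc M → P x ≤ M
  value≤max x<n = ≤-pred (bounded x<n)

  ascent : ∀ {x y} → x < y → y < suc M → ¬ (P y < P x) → P x < P y
  ascent {x} {y} x<y y<n ¬descent with <-cmp (P x) (P y)
  ... | tri< up _ _ = up
  ... | tri≈ _ eq _ = ⊥-elim (<-irrefl (injective (<-trans x<y y<n) y<n eq) x<y)
  ... | tri> _ _ down = ⊥-elim (¬descent down)

  no-descent-below-first : ∀ {x y} → x < y → y < suc M → P y < P x → P x < P 0 → ⊥
  no-descent-below-first {zero} _ _ _ Px<Px = <-irrefl refl Px<Px
  no-descent-below-first {suc x} x<y y<n = avoids321 (s≤s z≤n) x<y y<n

  module _ (1<n : 1 < suc M) where

    0<value : ∀ {y} → y < suc M → y ≢ 1 → 0 < P y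
    0<value {y} y<n y≢1 with P y in Py
    ... | zero = ⊥-elim (y≢1 (injective y<n 1<n (trans Py (sym second≡0))))
    ... | suc _ = s≤s z≤n

    -- The 0 at position 1 turns every 213 after it into a 1324.
    no-213-after-second : ∀ {x y z} → 1 < x → x < y → y < z → z < suc M →
                          P y < P x → P x < P z → ⊥
    no-213-after-second {y = y} 1<x x<y y<z z<n = avoids1324 1<x x<y y<z z<n
      (subst (_< P y) (sym second≡0) (0<value (<-trans y<z z<n) (λ y≡1 → <-irrefl (sym y≡1) (<-trans 1<x x<y))))

    module AroundMax {q : ℕ} (q<n : q < suc M) (Pq≡M : P q ≡ M) where

      value<max : ∀ {x} → x < suc M → x ≢ q → P x < M
      value<max x<n x≢q with m≤n⇒m<n∨m≡n (value≤max x<n)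
      ... | inj₁ Px<M = Px<M
      ... | inj₂ Px≡M = ⊥-elim (x≢q (injective x<n q<n (trans Px≡M (sym Pq≡M))))

      no-descent-before-max : ∀ {x y} → 1 < x → x < y → y < q → P y < P x → ⊥
      no-descent-before-max 1<x x<y y<q descent = no-213-after-second 1<x x<y y<q q<n descent
        (subst (_ <_) (sym Pq≡M) (value<max (<-trans x<y (<-trans y<q q<n)) (λ x≡q → <-irrefl x≡q (<-trans x<y y<q))))

      no-descent-after-max : ∀ {x y} → q < x → x < y → y < suc M → P y < P x → ⊥
      no-descent-after-max q<x x<y y<n descent = avoids321 q<x x<y y<n descent
        (subst (_ <_) (sym Pq≡M) (value<max (<-trans x<y y<n) (λ x≡q → <-irrefl (sym x≡q) q<x)))

      -- Before the maximum every entry ascends to its right neighbour, so an entry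
      -- one above a later one, across the maximum, is a Fishburn pattern.
      no-successor-across-max : ∀ {x y} → 1 < x → x < q → q < y → y < suc M → P x ≡ suc (P y) → ⊥
      no-successor-across-max {x} {y} 1<x x<q q<y y<n Px≡1+Py =
        fishburn (<-trans x<q q<y) y<n (≤-<-trans x<q q<n) (subst (P y <_) (sym Px≡1+Py) ≤-refl) rises Px≡1+Py
        where
        rises : P x < P (suc x)
        rises with m≤n⇒m<n∨m≡n x<q
        ... | inj₁ x+1<q = ascent ≤-refl (<-trans x+1<q q<n) (no-descent-before-max 1<x ≤-refl x+1<q)
        ... | inj₂ refl = subst (_ <_) (sym Pq≡M) (value<max (<-trans x<q q<n) (λ x≡q → <-irrefl x≡q x<q))

      predecessor-precedes : ∀ {p z} → 1 < p → p < q → P p ≡ suc z → ∃ λ s → s < p × P s ≡ z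
      predecessor-precedes {p} {z} 1<p p<q Pp≡1+z
        with surjective (<-trans (subst (z <_) (sym Pp≡1+z) ≤-refl) (bounded (<-trans p<q q<n)))
      ... | s , s<n , Ps≡z with <-cmp s p
      ... | tri< s<p _ _ = s , s<p , Ps≡z
      ... | tri≈ _ refl _ = ⊥-elim (<-irrefl (trans (sym Ps≡z) Pp≡1+z) ≤-refl)
      ... | tri> _ _ p<s with <-cmp s q
      ...   | tri< s<q _ _ = ⊥-elim (no-descent-before-max 1<p p<s s<q (subst₂ _<_ (sym Ps≡z) (sym Pp≡1+z) ≤-refl))
      ...   | tri≈ _ refl _ =
        ⊥-elim (<-irrefl (trans (sym Ps≡z) Pq≡M) (subst (_≤ M) Pp≡1+z (value≤max (<-trans p<q q<n))))
      ...   | tri> _ _ q<s = ⊥-elim (no-successor-across-max 1<p p<q q<s s<n (trans Pp≡1+z (cong suc (sym Ps≡z))))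

value-taken-later : ∀ {n P F} → IsCountedFun n P → IsCountedFun n F → ∀ {p} → p < n →
  (∀ r → r < p → P r ≡ F r) → P p ≢ F p → ∃ λ r → p < r × r < n × P r ≡ F p
value-taken-later isP isF {p} p<n agree Pp≢Fp with IsCountedFun.surjective isP (IsCountedFun.bounded isF p<n)
... | r , r<n , Pr≡Fp with <-cmp r p
... | tri< r<p _ _ = ⊥-elim (<-irrefl (IsCountedFun.injective isF (<-trans r<p p<n) p<n (trans (sym (agree r r<p)) Pr≡Fp)) r<p)
... | tri≈ _ refl _ = ⊥-elim (Pp≢Fp Pr≡Fp)
... | tri> _ _ p<r = r , p<r , r<n , Pr≡Fp

module UniqueIncreasingTail {M : ℕ} {P F : ℕ → ℕ}
  (isP : IsCountedFun (suc M) P) (isF : IsCountedFun (suc M) F) (1<n : 1 < suc M)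
  {a q : ℕ} (P0≡a : P 0 ≡ a) (F0≡a : F 0 ≡ a) (q<n : q < suc M) (Pq≡M : P q ≡ M) (Fq≡M : F q ≡ M)
  (F-increasing : ∀ {x y} → 1 < x → x < y → y < suc M → x ≢ q → y ≢ q → F x < F y)
  (no-split : ∀ {x y} → 1 < x → x < q → q < y → y < suc M → a < P x → P y < a → ⊥) where

  open IsCountedFun isP
  private module F = IsCountedFun isF
  open CountedFunProperties isP
  open AroundMax 1<n q<n Pq≡M

  module FirstDifference {p : ℕ} (1<p : 1 < p) (p<n : p < suc M) (p≢q : p ≢ q)
    (agree : ∀ r → r < p → P r ≡ F r) (Pp≢Fp : P p ≢ F p) where

    Fp<Pp : F p < P p
    Fp<Pp with value-taken-later isF isP p<n (λ r r<p → sym (agree r r<p)) (λ eq → Pp≢Fp (sym eq))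
    ... | s , p<s , s<n , Fs≡Pp with s ≟ q
    ...   | yes refl = ⊥-elim (p≢q (injective p<n q<n (trans (sym Fs≡Pp) (trans Fq≡M (sym Pq≡M)))))
    ...   | no s≢q = subst (F p <_) Fs≡Pp (F-increasing 1<p p<s s<n p≢q s≢q)

    -- The predecessor of P p must precede p, where F, which agrees with P there, is too small.
    predecessor-missing : p < q → a < F p → ⊥
    predecessor-missing p<q a<Fp with <⇒≡suc Fp<Pp
    ... | z , Pp≡1+z , Fp≤z with predecessor-precedes 1<p p<q Pp≡1+z
    ... | s , s<p , Ps≡z = <-irrefl (trans (sym (agree s s<p)) Ps≡z) (<-≤-trans (F-below s s<p) Fp≤z)
      where
      F-below : ∀ t → t < p → F t < F p
      F-below zero _ = subst (_< F p) (sym F0≡a) a<Fp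
      F-below (suc zero) _ = subst (_< F p) (sym F.second≡0) (≤-<-trans z≤n a<Fp)
      F-below t@(suc (suc _)) t<p =
        F-increasing (s≤s (s≤s z≤n)) t<p p<n (λ t≡q → <-irrefl t≡q (<-trans t<p p<q)) p≢q

    impossible : ⊥
    impossible with value-taken-later isP isF p<n agree Pp≢Fp
    ... | r , p<r , r<n , Pr≡Fp with <-cmp p q
    ... | tri≈ _ p≡q _ = p≢q p≡q
    ... | tri> _ _ q<p = no-descent-after-max q<p p<r r<n Pr<Pp
      where Pr<Pp = subst (_< P p) (sym Pr≡Fp) Fp<Pp
    ... | tri< p<q _ _ with <-cmp r q
    ...   | tri< r<q _ _ = no-descent-before-max 1<p p<r r<q (subst (_< P p) (sym Pr≡Fp) Fp<Pp)
    ...   | tri≈ _ refl _ = p≢q (F.injective p<n q<n (trans (sym Pr≡Fp) (trans Pq≡M (sym Fq≡M))))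
    ...   | tri> _ _ q<r with <-cmp (F p) a
    ...     | tri≈ _ Fp≡a _ = <-irrefl (sym (F.injective p<n (s≤s z≤n) (trans Fp≡a (sym F0≡a)))) (<-trans (s≤s z≤n) 1<p)
    ...     | tri> _ _ a<Fp = predecessor-missing p<q a<Fp
    ...     | tri< Fp<a _ _ with <-cmp (P p) a
    ...       | tri< Pp<a _ _ = no-descent-below-first p<r r<n (subst (_< P p) (sym Pr≡Fp) Fp<Pp) (subst (P p <_) (sym P0≡a) Pp<a)
    ...       | tri≈ _ Pp≡a _ = <-irrefl (sym (injective p<n (s≤s z≤n) (trans Pp≡a (sym P0≡a)))) (<-trans (s≤s z≤n) 1<p)
    ...       | tri> _ _ a<Pp = no-split 1<p p<q q<r r<n a<Pp (subst (_< a) (sym Pr≡Fp) Fp<a)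

  agree : ∀ {x} → x < suc M → P x ≡ F x
  agree = agree-by-induction step
    where
    step : ∀ p → p < suc M → (∀ r → r < p → P r ≡ F r) → P p ≡ F p
    step zero _ _ = trans P0≡a (sym F0≡a)
    step (suc zero) _ _ = trans second≡0 (sym F.second≡0)
    step p@(suc (suc _)) p<n agree with p ≟ q | P p ≟ F p
    ... | yes refl | _ = trans Pq≡M (sym Fq≡M)
    ... | no _ | yes Pp≡Fp = Pp≡Fp
    ... | no p≢q | no Pp≢Fp = ⊥-elim (FirstDifference.impossible (s≤s (s≤s z≤n)) p<n p≢q agree Pp≢Fp)

module IncreasingTail {M : ℕ} {F : ℕ → ℕ} (0<M : 0 < M) {a q : ℕ}
  (bounded : ∀ {x} → x < suc M → F x < suc M)
  (F0≡a : F 0 ≡ a) (F1≡0 : F 1 ≡ 0) (0<a : 0 < a)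
  (Fq≡M : F q ≡ M) (a≡M⇒q≡0 : a ≡ M → q ≡ 0)
  (F-increasing : ∀ {x y} → 1 < x → x < y → y < suc M → x ≢ q → y ≢ q → F x < F y)
  (F-range : ∀ {x} → 1 < x → x < suc M → x ≢ q → 0 < F x × F x ≢ a × F x < M) where

  private
    2≤ : ∀ {x} → 2 ≤ suc (suc x)
    2≤ = s≤s (s≤s z≤n)

    value≤max : ∀ {x} → x < suc M → F x ≤ M
    value≤max x<n = ≤-pred (bounded x<n)

    descent-starts-at-max : ∀ {j k} → 1 < j → j < k → k < suc M → F k < F j → j ≡ q
    descent-starts-at-max {j} {k} 1<j j<k k<n Fk<Fj with j ≟ q | k ≟ q
    ... | yes j≡q | _ = j≡q
    ... | no _ | yes refl = ⊥-elim (<-irrefl refl (<-≤-trans (subst (_< F j) Fq≡M Fk<Fj) (value≤max (<-trans j<k k<n))))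
    ... | no j≢q | no k≢q = ⊥-elim (<-asym Fk<Fj (F-increasing 1<j j<k k<n j≢q k≢q))

    no-rise-after-descent : ∀ {j k l} → 0 < j → j < k → k < suc M → l < suc M → F k < F j → F j < F l → ⊥
    no-rise-after-descent {suc zero} {k} _ _ _ _ Fk<F1 _ = n≮0 (subst (F k <_) F1≡0 Fk<F1)
    no-rise-after-descent {suc (suc _)} _ j<k k<n l<n Fk<Fj Fj<Fl with descent-starts-at-max 2≤ j<k k<n Fk<Fj
    ... | refl = <-irrefl refl (<-≤-trans (subst (_< _) Fq≡M Fj<Fl) (value≤max l<n))

    distinct : ∀ {x y} → x < y → y < suc M → F x ≢ F y
    distinct {zero} {suc zero} _ _ eq = <-irrefl (sym (trans (sym F0≡a) (trans eq F1≡0))) 0<a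
    distinct {zero} {y@(suc (suc _))} 0<y y<n eq with y ≟ q
    ... | yes refl = <-irrefl (sym (a≡M⇒q≡0 (trans (sym F0≡a) (trans eq Fq≡M)))) 0<y
    ... | no y≢q = proj₁ (proj₂ (F-range 2≤ y<n y≢q)) (trans (sym eq) F0≡a)
    distinct {suc zero} {suc zero} (s≤s ())
    distinct {suc zero} {y@(suc (suc _))} _ y<n eq with y ≟ q
    ... | yes refl = <-irrefl (trans (sym F1≡0) (trans eq Fq≡M)) 0<M
    ... | no y≢q = <-irrefl (trans (sym F1≡0) eq) (proj₁ (F-range 2≤ y<n y≢q))
    distinct {x@(suc (suc _))} {y} x<y y<n eq with x ≟ q | y ≟ q
    ... | yes refl | yes refl = <-irrefl refl x<y
    ... | yes refl | no y≢q = <-irrefl (trans (sym eq) Fq≡M) (proj₂ (proj₂ (F-range (≤-trans 2≤ (<⇒≤ x<y)) y<n y≢q)))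
    ... | no x≢q | yes refl = <-irrefl (trans eq Fq≡M) (proj₂ (proj₂ (F-range 2≤ (<-trans x<y y<n) x≢q)))
    ... | no x≢q | no y≢q = <-irrefl eq (F-increasing 2≤ x<y y<n x≢q y≢q)

  isCountedFun : IsCountedFun (suc M) F
  isCountedFun = record
    { bounded = bounded
    ; injective = injective-from-distinct distinct
    ; avoids321 = λ i<j j<k k<n →
        no-rise-after-descent (≤-trans (s≤s z≤n) i<j) j<k k<n (<-trans i<j (<-trans j<k k<n))
    ; avoids1324 = λ i<j j<k k<l l<n _ →
        no-rise-after-descent (≤-trans (s≤s z≤n) i<j) j<k (<-trans k<l l<n) l<n
    ; fishburn = fishburn
    ; second≡0 = F1≡0
    }
    where

    fishburn : ∀ {i j} → i < j → j < suc M → suc i < suc M → F j < F i → F i < F (suc i) → F i ≡ suc (F j) → ⊥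
    fishburn {zero} _ _ _ _ F0<F1 _ = n≮0 (subst (F 0 <_) F1≡0 F0<F1)
    fishburn {suc _} i<j j<n i+1<n Fj<Fi Fi<Fi+1 _ = no-rise-after-descent (s≤s z≤n) i<j j<n i+1<n Fj<Fi Fi<Fi+1

-- Families A and C

skip : ℕ → ℕ → ℕ
skip a r with r <? a
... | yes _ = r
... | no _ = suc r

skip-mono-< : ∀ a {r r′} → r < r′ → skip a r < skip a r′
skip-mono-< a {r} {r′} r<r′ with r <? a | r′ <? a
... | yes _ | yes _ = r<r′
... | yes _ | no _ = <-trans r<r′ (n<1+n r′)
... | no r≮a | yes r′<a = ⊥-elim (r≮a (<-trans r<r′ r′<a))
... | no _ | no _ = s≤s r<r′

skip≢ : ∀ a r → skip a r ≢ a
skip≢ a r with r <? a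
... | yes r<a = λ r≡a → <-irrefl r≡a r<a
... | no r≮a = λ 1+r≡a → r≮a (subst (r <_) 1+r≡a (n<1+n r))

r≤skip : ∀ a r → r ≤ skip a r
r≤skip a r with r <? a
... | yes _ = ≤-refl
... | no _ = n≤1+n r

skip≤1+r : ∀ a r → skip a r ≤ suc r
skip≤1+r a r with r <? a
... | yes _ = n≤1+n r
... | no _ = ≤-refl

-- The rank of position 2 + x among the positions 2, 3, … other than 2 + s.
rankAvoiding : ℕ → ℕ → ℕ
rankAvoiding s x with x <? s
... | yes _ = suc x
... | no _ = x

rankAvoiding-mono-< : ∀ s {x x′} → x < x′ → x′ ≢ s → rankAvoiding s x < rankAvoiding s x′
rankAvoiding-mono-< s {x} {x′} x<x′ x′≢s with x <? s | x′ <? s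
... | yes _ | yes _ = s≤s x<x′
... | yes x<s | no x′≮s = ≤-<-trans x<s (≤∧≢⇒< (≮⇒≥ x′≮s) (λ s≡x′ → x′≢s (sym s≡x′)))
... | no x≮s | yes x′<s = ⊥-elim (x≮s (<-trans x<x′ x′<s))
... | no _ | no _ = x<x′

0<rankAvoiding : ∀ {s x} → x ≢ s → 0 < rankAvoiding s x
0<rankAvoiding {s} {x} x≢s with x <? s
... | yes _ = s≤s z≤n
... | no x≮s with x
...   | zero = ⊥-elim (x≢s (sym (n≤0⇒n≡0 (≮⇒≥ x≮s))))
...   | suc _ = s≤s z≤n

rankAvoiding≤ : ∀ {s x k} → s ≤ k → x ≤ k → rankAvoiding s x ≤ k
rankAvoiding≤ {s} {x} s≤k x≤k with x <? s
... | yes x<s = ≤-trans x<s s≤k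
... | no _ = x≤k

-- Family A, for n = k + 3: first entry a = t + 1, the 0 at position 1, the
-- maximum k + 2 at position q = s + 2, and all other values increasing.
familyA : (k t s : ℕ) → ℕ → ℕ
familyA k t s zero = suc t
familyA k t s (suc zero) = 0
familyA k t s (suc (suc x)) with x ≟ s
... | yes _ = suc (suc k)
... | no _ = skip (suc t) (rankAvoiding s x)

familyC : (k : ℕ) → ℕ → ℕ
familyC k zero = suc (suc k)
familyC k (suc x) = x

module FamilyA (k t s : ℕ) (t≤k : t ≤ k) (s≤k : s ≤ k) where

  private
    M = suc (suc k)
    F = familyA k t s

  value-at-max : F (suc (suc s)) ≡ M
  value-at-max with s ≟ s
  ... | yes _ = refl
  ... | no s≢s = ⊥-elim (s≢s refl)

  value-elsewhere : ∀ {x} → suc (suc x) ≢ suc (suc s) → F (suc (suc x)) ≡ skip (suc t) (rankAvoiding s x)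
  value-elsewhere {x} x+2≢q with x ≟ s
  ... | yes refl = ⊥-elim (x+2≢q refl)
  ... | no _ = refl

  max-position<n : suc (suc s) < suc M
  max-position<n = s≤s (s≤s (s≤s s≤k))

  increasing : ∀ {x y} → 1 < x → x < y → y < suc M → x ≢ suc (suc s) → y ≢ suc (suc s) → F x < F y
  increasing {suc (suc x)} {suc (suc y)} (s≤s (s≤s _)) (s≤s (s≤s x<y)) _ x≢q y≢q =
    subst₂ _<_ (sym (value-elsewhere x≢q)) (sym (value-elsewhere y≢q))
      (skip-mono-< (suc t) (rankAvoiding-mono-< s x<y (λ y≡s → y≢q (cong (λ z → suc (suc z)) y≡s))))

  range : ∀ {x} → 1 < x → x < suc M → x ≢ suc (suc s) → 0 < F x × F x ≢ suc t × F x < M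
  range {suc (suc x)} (s≤s (s≤s _)) (s≤s (s≤s (s≤s x≤k))) x≢q rewrite value-elsewhere x≢q =
      ≤-trans (0<rankAvoiding (λ x≡s → x≢q (cong (λ z → suc (suc z)) x≡s))) (r≤skip (suc t) _)
    , skip≢ (suc t) (rankAvoiding s x)
    , s≤s (≤-trans (skip≤1+r (suc t) _) (s≤s (rankAvoiding≤ s≤k x≤k)))

  bounded : ∀ {x} → x < suc M → F x < suc M
  bounded {zero} _ = s≤s (s≤s (≤-trans t≤k (n≤1+n k)))
  bounded {suc zero} _ = s≤s z≤n
  bounded {x@(suc (suc _))} x<n with x ≟ suc (suc s)
  ... | yes refl = subst (_< suc M) (sym value-at-max) ≤-refl
  ... | no x≢q = <-trans (proj₂ (proj₂ (range (s≤s (s≤s z≤n)) x<n x≢q))) (n<1+n M)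

  isCountedFun : IsCountedFun (suc M) F
  isCountedFun = IncreasingTail.isCountedFun (s≤s z≤n) bounded refl refl (s≤s z≤n) value-at-max
    (λ t+1≡M → ⊥-elim (<-irrefl t+1≡M (s≤s (s≤s t≤k)))) increasing range

module FamilyC (k : ℕ) where

  private
    M = suc (suc k)
    F = familyC k

  increasing : ∀ {x y} → 1 < x → x < y → y < suc M → x ≢ 0 → y ≢ 0 → F x < F y
  increasing {y = suc _} (s≤s (s≤s _)) x<y _ _ _ = ≤-pred x<y

  range : ∀ {x} → 1 < x → x < suc M → x ≢ 0 → 0 < F x × F x ≢ M × F x < M
  range (s≤s (s≤s _)) x<n _ = s≤s z≤n , (λ Fx≡M → <-irrefl Fx≡M (≤-pred x<n)) , ≤-pred x<n

  bounded : ∀ {x} → x < suc M → F x < suc M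
  bounded {zero} _ = ≤-refl
  bounded {suc _} x+1<n = <-trans (≤-pred x+1<n) (n<1+n M)

  isCountedFun : IsCountedFun (suc M) F
  isCountedFun = IncreasingTail.isCountedFun (s≤s z≤n) bounded refl refl (s≤s z≤n) refl (λ _ → refl) increasing range

-- Family B

-- The entries a, 0, 1, …, j, a + 1, …, M, j + 1, …, a - 1 with a = j + c + 1 and
-- M = j + m + c + 1: after the first entry come the runs low, high and middle
-- (see Position below) of lengths j + 1, m and c.
familyB : (j m c : ℕ) → ℕ → ℕ
familyB j m c zero = suc (j + c)
familyB j m c (suc x) with x ≤? j
... | yes _ = x
... | no _ with x ∸ suc j <? m
...   | yes _ = suc (suc (j + c)) + (x ∸ suc j)
...   | no _ = suc j + (x ∸ suc j ∸ m)

module FamilyB (j m c : ℕ) where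

  a : ℕ
  a = suc (j + c)

  M : ℕ
  M = suc (j + m + c)

  private
    F = familyB j m c

  data Position : ℕ → Set where
    start  : Position 0
    low    : ∀ x → x ≤ j → Position (suc x)
    high   : ∀ y → y < m → Position (suc (suc j + y))
    middle : ∀ z → z < c → Position (suc (suc j + m + z))

  position : ∀ {p} → p < suc M → Position p
  position {zero} _ = start
  position {suc x} x+1<n with x ≤? j
  ... | yes x≤j = low x x≤j
  ... | no x≰j with x ∸ suc j <? m
  ...   | yes y<m = subst (λ p → Position (suc p)) (m+[n∸m]≡n (≰⇒> x≰j)) (high (x ∸ suc j) y<m)
  ...   | no y≮m = subst (λ p → Position (suc p)) j+m+z≡x (middle z z<c)
    where
    z = x ∸ suc j ∸ m
    j+m+z≡x : suc j + m + z ≡ x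
    j+m+z≡x = trans (+-assoc (suc j) m z) (trans (cong (suc j +_) (m+[n∸m]≡n (≮⇒≥ y≮m))) (m+[n∸m]≡n (≰⇒> x≰j)))
    z<c : z < c
    z<c = +-cancelˡ-< (suc j + m) z c (subst (_< suc j + m + c) (sym j+m+z≡x) (≤-pred x+1<n))

  value-low : ∀ {x} → x ≤ j → F (suc x) ≡ x
  value-low {x} x≤j with x ≤? j
  ... | yes _ = refl
  ... | no x≰j = ⊥-elim (x≰j x≤j)

  value-high : ∀ {y} → y < m → F (suc (suc j + y)) ≡ suc a + y
  value-high {y} y<m with suc j + y ≤? j
  ... | yes j+1+y≤j = ⊥-elim (m+n≮m j y j+1+y≤j)
  ... | no _ with suc j + y ∸ suc j <? m
  ...   | yes _ = cong (suc a +_) (m+n∸m≡n (suc j) y)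
  ...   | no y≮m = ⊥-elim (y≮m (subst (_< m) (sym (m+n∸m≡n (suc j) y)) y<m))

  private
    middle-offset : ∀ z → suc j + m + z ∸ suc j ≡ m + z
    middle-offset z = trans (cong (_∸ suc j) (+-assoc (suc j) m z)) (m+n∸m≡n (suc j) (m + z))

  value-middle : ∀ {z} → F (suc (suc j + m + z)) ≡ suc j + z
  value-middle {z} with suc j + m + z ≤? j
  ... | yes j+1+m+z≤j = ⊥-elim (m+n≮m j (m + z) (subst (λ w → suc w ≤ j) (+-assoc j m z) j+1+m+z≤j))
  ... | no _ with suc j + m + z ∸ suc j <? m
  ...   | yes m+z<m = ⊥-elim (m+n≮m m z (subst (_< m) (middle-offset z) m+z<m))
  ...   | no _ = cong (suc j +_) (trans (cong (_∸ m) (middle-offset z)) (m+n∸m≡n m z))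

  a+m≡M : a + m ≡ M
  a+m≡M = cong suc (trans (+-assoc j c m) (trans (cong (j +_) (+-comm c m)) (sym (+-assoc j m c))))

  a≤M : a ≤ M
  a≤M = subst (a ≤_) a+m≡M (m≤m+n a m)

  j<a : j < a
  j<a = s≤s (m≤m+n j c)

  low<a : ∀ {x} → x ≤ j → F (suc x) < a
  low<a x≤j = subst (_< a) (sym (value-low x≤j)) (≤-<-trans x≤j j<a)

  a<high : ∀ {y} → y < m → a < F (suc (suc j + y))
  a<high y<m = subst (a <_) (sym (value-high y<m)) (s≤s (m≤m+n a _))

  1+j+z<a : ∀ {z} → z < c → suc j + z < a
  1+j+z<a {z} z<c = s≤s (subst (_≤ j + c) (+-suc j z) (+-monoʳ-≤ j z<c))

  middle<a : ∀ {z} → z < c → F (suc (suc j + m + z)) < a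
  middle<a z<c = subst (_< a) (sym value-middle) (1+j+z<a z<c)

  high≤M : ∀ {y} → y < m → F (suc (suc j + y)) ≤ M
  high≤M {y} y<m = subst (_≤ M) (sym (value-high y<m))
    (subst (suc (a + y) ≤_) a+m≡M (subst (_≤ a + m) (+-suc a y) (+-monoʳ-≤ a y<m)))

  high-not-before-low : ∀ {x y} → x ≤ j → suc (suc j + y) < suc x → ⊥
  high-not-before-low {x} {y} x≤j lt = m+n≮m j y (≤-trans (n≤1+n _) (≤-pred (≤-trans lt (s≤s x≤j))))

  middle-not-before-low : ∀ {x z} → x ≤ j → suc (suc j + m + z) < suc x → ⊥
  middle-not-before-low {x} {z} x≤j lt =
    m+n≮m j (m + z) (subst (λ w → suc w ≤ j) (+-assoc j m z) (≤-trans (n≤1+n _) (≤-pred (≤-trans lt (s≤s x≤j)))))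

  middle-not-before-high : ∀ {y z} → y < m → suc (suc j + m + z) < suc (suc j + y) → ⊥
  middle-not-before-high {y} {z} y<m lt = m+n≮m m z (≤-trans (+-cancelˡ-< (suc j) (m + z) y
    (subst (_< suc j + y) (+-assoc (suc j) m z) (≤-pred lt))) (<⇒≤ y<m))

  high-index-< : ∀ {y y′} → suc (suc j + y) < suc (suc j + y′) → y < y′
  high-index-< lt = +-cancelˡ-< (suc j) _ _ (≤-pred lt)

  middle-index-< : ∀ {z z′} → suc (suc j + m + z) < suc (suc j + m + z′) → z < z′
  middle-index-< lt = +-cancelˡ-< (suc j + m) _ _ (≤-pred lt)

  ascent-or-split : ∀ {x y} → Position x → Position y → 1 < x → x < y → F x < F y ⊎ (F y < a × a < F x)
  ascent-or-split (low x x≤j) (low y y≤j) _ x<y =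
    inj₁ (subst₂ _<_ (sym (value-low x≤j)) (sym (value-low y≤j)) (≤-pred x<y))
  ascent-or-split (low x x≤j) (high y y<m) _ _ = inj₁ (<-trans (low<a x≤j) (a<high y<m))
  ascent-or-split (low x x≤j) (middle z z<c) _ _ =
    inj₁ (subst₂ _<_ (sym (value-low x≤j)) (sym value-middle) (s≤s (≤-trans x≤j (m≤m+n j z))))
  ascent-or-split (high y y<m) (low x x≤j) _ lt = ⊥-elim (high-not-before-low x≤j lt)
  ascent-or-split (high y y<m) (high y′ y′<m) _ lt =
    inj₁ (subst₂ _<_ (sym (value-high y<m)) (sym (value-high y′<m)) (+-monoʳ-< (suc a) (high-index-< lt)))
  ascent-or-split (high y y<m) (middle z z<c) _ _ = inj₂ (middle<a z<c , a<high y<m)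
  ascent-or-split (middle z z<c) (low x x≤j) _ lt = ⊥-elim (middle-not-before-low x≤j lt)
  ascent-or-split (middle z z<c) (high y y<m) _ lt = ⊥-elim (middle-not-before-high y<m lt)
  ascent-or-split (middle z z<c) (middle z′ z′<c) _ lt =
    inj₁ (subst₂ _<_ (sym value-middle) (sym value-middle) (+-monoʳ-< (suc j) (middle-index-< lt)))

  below-a-after-split : ∀ {x y z} → Position x → Position y → Position z → x < y → y < z →
                        F y < a → a < F x → F z < a
  below-a-after-split start _ _ _ _ _ a<a = ⊥-elim (<-irrefl refl a<a)
  below-a-after-split (low _ x≤j) _ _ _ _ _ a<Fx = ⊥-elim (<-asym a<Fx (low<a x≤j))
  below-a-after-split (middle _ z<c) _ _ _ _ _ a<Fx = ⊥-elim (<-asym a<Fx (middle<a z<c))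
  below-a-after-split (high _ _) (low _ x≤j) _ lt _ _ _ = ⊥-elim (high-not-before-low x≤j lt)
  below-a-after-split (high _ _) (high _ y<m) _ _ _ Fy<a _ = ⊥-elim (<-asym Fy<a (a<high y<m))
  below-a-after-split (high _ _) (middle _ _) (low _ x≤j) _ lt _ _ = ⊥-elim (middle-not-before-low x≤j lt)
  below-a-after-split (high _ _) (middle _ _) (high _ y<m) _ lt _ _ = ⊥-elim (middle-not-before-high y<m lt)
  below-a-after-split (high _ _) (middle _ _) (middle _ z<c) _ _ _ _ = middle<a z<c

  private
    2≤ : ∀ {x} → 2 ≤ suc (suc x)
    2≤ = s≤s (s≤s z≤n)

    split : ∀ {x y} → 1 < x → x < y → y < suc M → F x < F y ⊎ (F y < a × a < F x)
    split 1<x x<y y<n = ascent-or-split (position (<-trans x<y y<n)) (position y<n) 1<x x<y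

    F1≡0 : F 1 ≡ 0
    F1≡0 = value-low z≤n

    value-bounded : ∀ {x} → Position x → F x < suc M
    value-bounded start = s≤s a≤M
    value-bounded (low _ x≤j) = <-trans (<-≤-trans (low<a x≤j) a≤M) (n<1+n M)
    value-bounded (high _ y<m) = s≤s (high≤M y<m)
    value-bounded (middle _ z<c) = <-trans (<-≤-trans (middle<a z<c) a≤M) (n<1+n M)

    value≢a : ∀ {y} → Position y → 0 < y → F y ≢ a
    value≢a (low _ x≤j) _ Fy≡a = <-irrefl Fy≡a (low<a x≤j)
    value≢a (high _ y<m) _ Fy≡a = <-irrefl (sym Fy≡a) (a<high y<m)
    value≢a (middle _ z<c) _ Fy≡a = <-irrefl Fy≡a (middle<a z<c)

    0<value : ∀ {y} → Position y → 1 < y → 0 < F y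
    0<value (low zero _) (s≤s ())
    0<value (low (suc x) x≤j) _ = subst (0 <_) (sym (value-low x≤j)) (s≤s z≤n)
    0<value (high _ y<m) _ = subst (0 <_) (sym (value-high y<m)) (s≤s z≤n)
    0<value (middle _ _) _ = subst (0 <_) (sym value-middle) (s≤s z≤n)

    distinct : ∀ {x y} → x < y → y < suc M → F x ≢ F y
    distinct {zero} 0<y y<n Fx≡Fy = value≢a (position y<n) 0<y (sym Fx≡Fy)
    distinct {suc zero} {suc zero} (s≤s ())
    distinct {suc zero} {suc (suc _)} _ y<n F1≡Fy = <-irrefl (trans (sym F1≡0) F1≡Fy) (0<value (position y<n) 2≤)
    distinct {suc (suc _)} x<y y<n Fx≡Fy with split 2≤ x<y y<n
    ... | inj₁ Fx<Fy = <-irrefl Fx≡Fy Fx<Fy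
    ... | inj₂ (Fy<a , a<Fx) = <-asym (subst (_< a) (sym Fx≡Fy) Fy<a) a<Fx

    descent-is-split : ∀ {j k} → 0 < j → j < k → k < suc M → F k < F j → F k < a × a < F j
    descent-is-split {suc zero} {k} _ _ _ Fk<F1 = ⊥-elim (n≮0 (subst (F k <_) F1≡0 Fk<F1))
    descent-is-split {suc (suc _)} _ j<k k<n Fk<Fj with split 2≤ j<k k<n
    ... | inj₁ Fj<Fk = ⊥-elim (<-asym Fk<Fj Fj<Fk)
    ... | inj₂ split = split

  isCountedFun : IsCountedFun (suc M) F
  isCountedFun = record
    { bounded = λ x<n → value-bounded (position x<n)
    ; injective = injective-from-distinct distinct
    ; avoids321 = avoids321
    ; avoids1324 = avoids1324
    ; fishburn = fishburn
    ; second≡0 = F1≡0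
    }
    where

    avoids321 : ∀ {i j k} → i < j → j < k → k < suc M → F k < F j → F j < F i → ⊥
    avoids321 {zero} 0<j j<k k<n Fk<Fj Fj<F0 = <-asym Fj<F0 (proj₂ (descent-is-split 0<j j<k k<n Fk<Fj))
    avoids321 {suc zero} {j} _ _ _ _ Fj<F1 = n≮0 (subst (F j <_) F1≡0 Fj<F1)
    avoids321 {suc (suc _)} i<j j<k k<n Fk<Fj Fj<Fi with split 2≤ i<j (<-trans j<k k<n)
    ... | inj₁ Fi<Fj = <-asym Fj<Fi Fi<Fj
    ... | inj₂ (Fj<a , _) = <-asym Fj<a (proj₂ (descent-is-split (≤-trans (s≤s z≤n) i<j) j<k k<n Fk<Fj))

    avoids1324 : ∀ {i j k l} → i < j → j < k → k < l → l < suc M → F i < F k → F k < F j → F j < F l → ⊥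
    avoids1324 i<j j<k k<l l<n _ Fk<Fj Fj<Fl with descent-is-split (≤-trans (s≤s z≤n) i<j) j<k (<-trans k<l l<n) Fk<Fj
    ... | Fk<a , a<Fj = <-asym (<-trans a<Fj Fj<Fl) (below-a-after-split
      (position (<-trans j<k (<-trans k<l l<n))) (position (<-trans k<l l<n)) (position l<n) j<k k<l Fk<a a<Fj)

    fishburn : ∀ {i j} → i < j → j < suc M → suc i < suc M → F j < F i → F i < F (suc i) → F i ≡ suc (F j) → ⊥
    fishburn {zero} _ _ _ _ F0<F1 _ = n≮0 (subst (F 0 <_) F1≡0 F0<F1)
    fishburn {suc _} i<j j<n _ Fj<Fi _ Fi≡1+Fj with descent-is-split (s≤s z≤n) i<j j<n Fj<Fi
    ... | Fj<a , a<Fi = <-irrefl refl (<-≤-trans a<Fi (subst (_≤ a) (sym Fi≡1+Fj) Fj<a))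

module UniqueFamilyB (j m c : ℕ) {P : ℕ → ℕ} (isP : IsCountedFun (suc (FamilyB.M j m c)) P)
  (0<c : 0 < c) (P0≡a : P 0 ≡ FamilyB.a j m c) {q : ℕ} (q<n : q < suc (FamilyB.M j m c))
  (Pq≡M : P q ≡ FamilyB.M j m c) (q+1<n : suc q < suc (FamilyB.M j m c))
  (Pq+1≡1+j : P (suc q) ≡ suc j) (a<Pq-1 : FamilyB.a j m c < P (pred q)) where

  open FamilyB j m c
  open IsCountedFun isP
  open CountedFunProperties isP

  private
    F = familyB j m c
    isF = FamilyB.isCountedFun j m c
    module F = IsCountedFun isF

    1<n : 1 < suc M
    1<n = s≤s (s≤s z≤n)

    1+j<a : suc j < a
    1+j<a = s≤s (subst (_≤ j + c) (+-comm j 1) (+-monoʳ-≤ j 0<c))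

  open AroundMax 1<n q<n Pq≡M

  below-high : ∀ {x y} → Position x → x < suc (suc j + y) → y < m → F x < suc a + y
  below-high start _ _ = s≤s (m≤m+n a _)
  below-high (low _ x≤j) _ _ = <-trans (low<a x≤j) (s≤s (m≤m+n a _))
  below-high (high y′ y′<m) lt _ = subst (_< _) (sym (value-high y′<m)) (+-monoʳ-< (suc a) (high-index-< lt))
  below-high (middle _ _) lt y<m = ⊥-elim (middle-not-before-high y<m lt)

  left-of-high : ∀ y → y < m → F (suc (j + y)) < a ⊎ ∃ λ y′ → y ≡ suc y′ × F (suc (j + y)) ≡ suc a + y′
  left-of-high zero _ = inj₁ (low<a (≤-reflexive (+-identityʳ j)))
  left-of-high (suc y′) y<m =
    inj₂ (y′ , refl , trans (cong (λ x → F (suc x)) (+-suc j y′)) (value-high (<-trans (n<1+n y′) y<m)))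

  module FirstDifference {p : ℕ} (1<p : 1 < p) (p<n : p < suc M)
    (agree : ∀ r → r < p → P r ≡ F r) (Pp≢Fp : P p ≢ F p) where

    taken-by-F : ∃ λ s → p < s × s < suc M × F s ≡ P p
    taken-by-F = value-taken-later isF isP p<n (λ r r<p → sym (agree r r<p)) (λ eq → Pp≢Fp (sym eq))

    taken-by-P : ∃ λ r → p < r × r < suc M × P r ≡ F p
    taken-by-P = value-taken-later isP isF p<n agree Pp≢Fp

    Fp<Pp : F p < a → F p < P p
    Fp<Pp Fp<a with taken-by-F
    ... | s , p<s , s<n , Fs≡Pp with ascent-or-split (position p<n) (position s<n) 1<p p<s
    ...   | inj₁ Fp<Fs = subst (F p <_) Fs≡Pp Fp<Fs
    ...   | inj₂ (_ , a<Fp) = ⊥-elim (<-asym Fp<a a<Fp)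

    Pp≢a : P p ≢ a
    Pp≢a Pp≡a = <-irrefl (sym (injective p<n (s≤s z≤n) (trans Pp≡a (sym P0≡a)))) (<-trans (s≤s z≤n) 1<p)

    impossible-low : F p ≤ j → ⊥
    impossible-low Fp≤j with taken-by-P
    ... | r , p<r , r<n , Pr≡Fp = compare-with-a (<-cmp (P p) a)
      where
      Pr<Pp : P r < P p
      Pr<Pp = subst (_< P p) (sym Pr≡Fp) (Fp<Pp (≤-<-trans Fp≤j j<a))

      Pr<Pq+1 : P r < P (suc q)
      Pr<Pq+1 = subst₂ _<_ (sym Pr≡Fp) (sym Pq+1≡1+j) (s≤s Fp≤j)

      compare-with-a : Tri (P p < a) (P p ≡ a) (a < P p) → ⊥
      compare-with-a (tri< Pp<a _ _) = no-descent-below-first p<r r<n Pr<Pp (subst (P p <_) (sym P0≡a) Pp<a)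
      compare-with-a (tri≈ _ Pp≡a _) = Pp≢a Pp≡a
      compare-with-a (tri> _ _ _) with <-cmp r q
      ... | tri< r<q _ _ = no-descent-before-max 1<p p<r r<q Pr<Pp
      ... | tri≈ _ refl _ = <-irrefl (trans (sym Pr≡Fp) Pq≡M) (<-≤-trans (≤-<-trans Fp≤j j<a) a≤M)
      ... | tri> _ _ q<r with m≤n⇒m<n∨m≡n q<r
      ...   | inj₂ refl = <-irrefl refl Pr<Pq+1
      ...   | inj₁ q+1<r = no-descent-below-first q+1<r r<n Pr<Pq+1 (subst₂ _<_ (sym Pq+1≡1+j) (sym P0≡a) 1+j<a)

    impossible-middle : ∀ {z} → z < c → p ≡ suc (suc j + m + z) → ⊥
    impossible-middle {z} z<c refl with taken-by-F | taken-by-P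
    ... | s , p<s , s<n , Fs≡Pp | r , p<r , r<n , Pr≡Fp =
      no-descent-below-first p<r r<n (subst (_< P p) (sym Pr≡Fp) (Fp<Pp (middle<a z<c)))
        (subst₂ _<_ Fs≡Pp (sym P0≡a) (later-below-a (position s<n) p<s))
      where
      later-below-a : ∀ {s} → Position s → p < s → F s < a
      later-below-a (low _ x≤j) lt = ⊥-elim (middle-not-before-low x≤j lt)
      later-below-a (high _ y<m) lt = ⊥-elim (middle-not-before-high y<m lt)
      later-below-a (middle _ z′<c) _ = middle<a z′<c

    p≤q-if-high : ∀ {y} → y < m → p ≡ suc (suc j + y) → p ≤ q
    p≤q-if-high {y} y<m refl with <-cmp q p
    ... | tri< q<p _ _ = ⊥-elim (<-irrefl (trans (sym (agree q q<p)) Pq≡M)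
            (<-≤-trans (below-high (position q<n) q<p y<m) (subst (_≤ M) (value-high y<m) (high≤M y<m))))
    ... | tri≈ _ q≡p _ = ≤-reflexive (sym q≡p)
    ... | tri> _ _ p<q = <⇒≤ p<q

    -- The run below a after the maximum starts with P (q + 1) = j + 1.
    middle-value-before-max : ∀ z → p < q → P p ≡ suc j + z → suc j + z < a → ⊥
    middle-value-before-max zero p<q Pp≡1+j+0 _ =
      <-irrefl (injective p<n q+1<n (trans Pp≡1+j+0 (trans (+-identityʳ (suc j)) (sym Pq+1≡1+j)))) (<-trans p<q (n<1+n q))
    middle-value-before-max (suc z) p<q Pp≡1+j+z 1+j+z<a = no-descent-below-first (<-trans p<q (n<1+n q)) q+1<n
      (subst₂ _<_ (sym Pq+1≡1+j) (sym Pp≡1+j+z) (m<m+n (suc j) (s≤s z≤n)))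
      (subst₂ _<_ (sym Pp≡1+j+z) (sym P0≡a) 1+j+z<a)

    high-then-middle : ∀ {y z} → y < m → p ≡ suc (suc j + y) → z < c → P p ≡ suc j + z → ⊥
    high-then-middle {y} {z} y<m p≡ z<c Pp≡1+j+z with m≤n⇒m<n∨m≡n (p≤q-if-high y<m p≡)
    ... | inj₂ refl = <-irrefl (trans (sym Pp≡1+j+z) Pq≡M) (<-≤-trans (1+j+z<a z<c) a≤M)
    ... | inj₁ p<q = middle-value-before-max z p<q Pp≡1+j+z (1+j+z<a z<c)

    -- The entry before the maximum is above a, so with the entry suc j right after
    -- the maximum and the later entry F p it forms a 213.
    high-at-max : ∀ {y} → y < m → p ≡ suc (suc j + y) → p ≡ q → ⊥
    high-at-max {y} y<m refl p≡q with taken-by-P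
    ... | r , p<r , r<n , Pr≡Fp = before-max (left-of-high y y<m)
      where
      Pr≡1+a+y : P r ≡ suc a + y
      Pr≡1+a+y = trans Pr≡Fp (value-high y<m)
      q+1<r : suc q < r
      q+1<r with m≤n⇒m<n∨m≡n (subst (_< r) p≡q p<r)
      ... | inj₁ q+1<r = q+1<r
      ... | inj₂ refl = ⊥-elim (<-irrefl (trans (sym Pq+1≡1+j) Pr≡1+a+y) (<-trans 1+j<a (s≤s (m≤m+n a y))))
      before-max : F (suc (j + y)) < a ⊎ ∃ (λ y″ → y ≡ suc y″ × F (suc (j + y)) ≡ suc a + y″) → ⊥
      before-max (inj₁ F<a) =
        <-asym (subst (λ x → a < P (pred x)) (sym p≡q) a<Pq-1) (subst (_< a) (sym (agree _ (n<1+n _))) F<a)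
      before-max (inj₂ (y″ , refl , F≡1+a+y″)) = no-213-after-second 1<n
          (s≤s (subst (1 ≤_) (sym (+-suc j y″)) (s≤s z≤n)))
          (subst (suc (j + y) <_) (cong suc p≡q) (<-trans (n<1+n _) (n<1+n p)))
          q+1<r r<n
          (subst₂ _<_ (sym Pq+1≡1+j) (sym P≡1+a+y″) (<-trans 1+j<a (s≤s (m≤m+n a y″))))
          (subst₂ _<_ (sym P≡1+a+y″) (sym Pr≡1+a+y) (+-monoʳ-< (suc a) (n<1+n y″)))
        where
        P≡1+a+y″ : P (suc (j + y)) ≡ suc a + y″
        P≡1+a+y″ = trans (agree _ (n<1+n _)) F≡1+a+y″

    high-then-high : ∀ {y y′} → y < m → p ≡ suc (suc j + y) → y < y′ → P p ≡ suc a + y′ → ⊥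
    high-then-high {y} {y′} y<m p≡ y<y′ Pp≡1+a+y′ with P p ≟ M
    ... | yes Pp≡M = high-at-max y<m p≡ (injective p<n q<n (trans Pp≡M (sym Pq≡M)))
    ... | no Pp≢M with predecessor-precedes 1<p p<q Pp≡1+a+y′
      where
      p<q : p < q
      p<q = ≤∧≢⇒< (p≤q-if-high y<m p≡) (λ p≡q → Pp≢M (trans (cong P p≡q) Pq≡M))
    ... | s , s<p , Ps≡a+y′ = <-irrefl (trans (sym (agree s s<p)) Ps≡a+y′)
            (<-≤-trans (below-high (position (<-trans s<p p<n)) (subst (s <_) p≡ s<p) y<m)
              (subst (_≤ a + y′) (+-suc a y) (+-monoʳ-≤ a y<y′)))

    impossible : ⊥
    impossible with position p<n | taken-by-F
    ... | start | _ = <-irrefl refl (<-trans (s≤s z≤n) 1<p)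
    ... | low x x≤j | _ = impossible-low (subst (_≤ j) (sym (value-low x≤j)) x≤j)
    ... | middle z z<c | _ = impossible-middle z<c refl
    ... | high y y<m | s , p<s , s<n , Fs≡Pp with position s<n
    ...   | start = n≮0 p<s
    ...   | low _ x≤j = high-not-before-low x≤j p<s
    ...   | middle z z<c = high-then-middle y<m refl z<c (trans (sym Fs≡Pp) value-middle)
    ...   | high y′ y′<m = high-then-high y<m refl (high-index-< p<s) (trans (sym Fs≡Pp) (value-high y′<m))

  agree : ∀ {x} → x < suc M → P x ≡ F x
  agree = agree-by-induction step
    where
    step : ∀ p → p < suc M → (∀ r → r < p → P r ≡ F r) → P p ≡ F p
    step zero _ _ = P0≡a
    step (suc zero) _ _ = trans second≡0 (sym F.second≡0)
    step p@(suc (suc _)) p<n agree with P p ≟ F p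
    ... | yes Pp≡Fp = Pp≡Fp
    ... | no Pp≢Fp = ⊥-elim (FirstDifference.impossible (s≤s (s≤s z≤n)) p<n agree Pp≢Fp)

-- Classification

-- In every shape the first entry is t + 1; in shape A the maximum is at position s + 2,
-- in shape B the entry right after the maximum is j + 1.
data Shape : Set where
  A : (t s : ℕ) → Shape
  B : (t j : ℕ) → Shape
  C : Shape

ValidShape : ℕ → Shape → Set
ValidShape k (A t s) = t ≤ k × s ≤ k
ValidShape k (B t j) = j < t × t < k
ValidShape k C = ⊤

shapeFun : ℕ → Shape → ℕ → ℕ
shapeFun k (A t s) = familyA k t s
shapeFun k (B t j) = familyB j (suc k ∸ t) (t ∸ j)
shapeFun k C = familyC k

familyB-max : ∀ {k t j} → j < t → t < k → FamilyB.M j (suc k ∸ t) (t ∸ j) ≡ suc (suc k)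
familyB-max {k} {t} {j} j<t t<k = cong suc (begin
  j + m + c   ≡⟨ +-assoc j m c ⟩
  j + (m + c) ≡⟨ cong (j +_) (+-comm m c) ⟩
  j + (c + m) ≡⟨ sym (+-assoc j c m) ⟩
  j + c + m   ≡⟨ cong (_+ m) (m+[n∸m]≡n (<⇒≤ j<t)) ⟩
  t + m       ≡⟨ m+[n∸m]≡n (<⇒≤ (<-trans t<k (n<1+n k))) ⟩
  suc k       ∎)
  where
  open ≡-Reasoning
  m = suc k ∸ t
  c = t ∸ j

shapeFun-isCountedFun : ∀ k sh → ValidShape k sh → IsCountedFun (3 + k) (shapeFun k sh)
shapeFun-isCountedFun k (A t s) (t≤k , s≤k) = FamilyA.isCountedFun k t s t≤k s≤k
shapeFun-isCountedFun k (B t j) (j<t , t<k) =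
  subst (λ M → IsCountedFun (suc M) (familyB j (suc k ∸ t) (t ∸ j))) (familyB-max j<t t<k) (FamilyB.isCountedFun j _ _)
shapeFun-isCountedFun k C _ = FamilyC.isCountedFun k

agree-with-familyB : ∀ {j m c M′ P} → FamilyB.M j m c ≡ M′ → IsCountedFun (suc M′) P → 0 < c →
  P 0 ≡ FamilyB.a j m c → ∀ {q} → q < suc M′ → P q ≡ M′ → suc q < suc M′ → P (suc q) ≡ suc j →
  FamilyB.a j m c < P (pred q) → ∀ {x} → x < suc M′ → P x ≡ familyB j m c x
agree-with-familyB {j} {m} {c} refl isP 0<c P0≡a q<n Pq≡M q+1<n Pq+1≡1+j a<Pq-1 =
  UniqueFamilyB.agree j m c isP 0<c P0≡a q<n Pq≡M q+1<n Pq+1≡1+j a<Pq-1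

module Classification (k : ℕ) {P : ℕ → ℕ} (isP : IsCountedFun (3 + k) P) where
  open IsCountedFun isP
  open CountedFunProperties isP

  private
    M = suc (suc k)

    1<n : 1 < suc M
    1<n = s≤s (s≤s z≤n)

  open AroundMax 1<n using (value<max)

  Classified : Set
  Classified = Σ Shape λ sh → ValidShape k sh × (∀ {x} → x < suc M → P x ≡ shapeFun k sh x)

  -- Among the counted permutations, exactly those of family B have a split.
  Split : ℕ → ℕ → Set
  Split a q = 3 ≤ q × a < P (pred q) × suc q < suc M × P (suc q) < a

  classify-C : P 0 ≡ M → Classified
  classify-C P0≡M = C , tt , UniqueIncreasingTail.agree isP (FamilyC.isCountedFun k) 1<n
    P0≡M refl (s≤s z≤n) P0≡M refl (FamilyC.increasing k) (λ _ ())

  classify-B : ∀ {t q} → P 0 ≡ suc t → q < suc M → P q ≡ M → Split (suc t) q → Classified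
  classify-B {t} {suc q′} P0≡1+t q<n Pq≡M (3≤q , 1+t<Pq′ , q+1<n , Pq+1<1+t)
    with <⇒≡suc (0<value 1<n q+1<n (λ q+1≡1 → <-irrefl (sym (suc-injective q+1≡1)) (<-trans (s≤s z≤n) 3≤q)))
  ... | j , Pq+1≡1+j , _ = B t j , (j<t , t<k) ,
      agree-with-familyB (familyB-max j<t t<k) isP (m<n⇒0<n∸m j<t) (trans P0≡1+t 1+t≡a)
        q<n Pq≡M q+1<n Pq+1≡1+j (subst (_< P q′) 1+t≡a 1+t<Pq′)
    where
    j<t : j < t
    j<t = ≤-pred (subst (_< suc t) Pq+1≡1+j Pq+1<1+t)
    t<k : t < k
    t<k = ≤-pred (≤-pred (<-≤-trans (s≤s 1+t<Pq′)
            (value<max q<n Pq≡M (<-trans (n<1+n q′) q<n) (λ q′≡q → <-irrefl q′≡q (n<1+n q′)))))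
    1+t≡a : suc t ≡ FamilyB.a j (suc k ∸ t) (t ∸ j)
    1+t≡a = cong suc (sym (m+[n∸m]≡n (<⇒≤ j<t)))

  -- Without a split, an entry above a before the maximum and one below a after it
  -- would propagate, by the monotone runs, to the neighbours of the maximum.
  no-split-anywhere : ∀ {t q} → q < suc M → P q ≡ M → ¬ Split (suc t) q →
    ∀ {x y} → 1 < x → x < q → q < y → y < suc M → suc t < P x → P y < suc t → ⊥
  no-split-anywhere {t} {suc q′} q<n Pq≡M ¬split {x} {y} 1<x x<q q<y y<n a<Px Py<a =
    ¬split (≤-trans (s≤s 1<x) x<q , a<Pq′ , ≤-<-trans q<y y<n , Pq+1<a)
    where
    open AroundMax 1<n q<n Pq≡M
    a<Pq′ : suc t < P q′
    a<Pq′ with m≤n⇒m<n∨m≡n (≤-pred x<q)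
    ... | inj₂ refl = a<Px
    ... | inj₁ x<q′ = <-trans a<Px (ascent x<q′ (<-trans (n<1+n q′) q<n) (no-descent-before-max 1<x x<q′ (n<1+n q′)))
    Pq+1<a : P (suc (suc q′)) < suc t
    Pq+1<a with m≤n⇒m<n∨m≡n q<y
    ... | inj₂ refl = Py<a
    ... | inj₁ q+1<y = <-trans (ascent q+1<y y<n (no-descent-after-max (n<1+n _) q+1<y y<n)) Py<a

  classify-A : ∀ {t q} → P 0 ≢ M → P 0 ≡ suc t → q < suc M → P q ≡ M → ¬ Split (suc t) q → Classified
  classify-A {q = zero} P0≢M _ _ P0≡M _ = ⊥-elim (P0≢M P0≡M)
  classify-A {q = suc zero} _ _ _ P1≡M _ = ⊥-elim (0≢1+n (trans (sym second≡0) P1≡M))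
  classify-A {t} {suc (suc s)} P0≢M P0≡1+t q<n Pq≡M ¬split = A t s , (t≤k , s≤k) ,
    UniqueIncreasingTail.agree isP (FamilyA.isCountedFun k t s t≤k s≤k) 1<n P0≡1+t refl
      q<n Pq≡M (FamilyA.value-at-max k t s t≤k s≤k) (FamilyA.increasing k t s t≤k s≤k)
      (no-split-anywhere q<n Pq≡M ¬split)
    where
    t≤k : t ≤ k
    t≤k = ≤-pred (≤-pred (≤∧≢⇒< (subst (_≤ M) P0≡1+t (value≤max (s≤s z≤n)))
                                (λ 1+t≡M → P0≢M (trans P0≡1+t 1+t≡M))))
    s≤k : s ≤ k
    s≤k = ≤-pred (≤-pred (≤-pred q<n))

  classify : Classified
  classify with P 0 ≟ M
  ... | yes P0≡M = classify-C P0≡M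
  ... | no P0≢M with <⇒≡suc (0<value 1<n (s≤s z≤n) (λ ())) | surjective (n<1+n M)
  ... | t , P0≡1+t , _ | q , q<n , Pq≡M
      with 3 ≤? q ×-dec suc t <? P (pred q) ×-dec suc q <? suc M ×-dec P (suc q) <? suc t
  ...   | yes split = classify-B P0≡1+t q<n Pq≡M split
  ...   | no ¬split = classify-A P0≢M P0≡1+t q<n Pq≡M ¬split

firstEntry : ℕ → Shape → ℕ
firstEntry k (A t _) = suc t
firstEntry k (B t _) = suc t
firstEntry k C = suc (suc k)

shapeFun-first : ∀ k sh → ValidShape k sh → shapeFun k sh 0 ≡ firstEntry k sh
shapeFun-first k (A t s) _ = refl
shapeFun-first k (B t j) (j<t , _) = cong suc (m+[n∸m]≡n (<⇒≤ j<t))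
shapeFun-first k C _ = refl

-- The maximum of family B is preceded by an entry above a and followed, later, by one below a.
familyB-not-increasing : ∀ j m c → 2 ≤ m → 0 < c → ∀ {N q} → FamilyB.M j m c ≡ N → q < suc N →
  familyB j m c q ≡ N →
  ¬ (∀ {x y} → 1 < x → x < y → y < suc N → x ≢ q → y ≢ q → familyB j m c x < familyB j m c y)
familyB-not-increasing j m@(suc (suc m′)) c (s≤s (s≤s _)) 0<c {q = q} refl q<n Fq≡M increasing =
  <-asym (increasing 2≤u (<-trans u<v v<w) w<n
           (λ u≡q → <-irrefl (trans u≡q (sym v≡q)) u<v) (λ w≡q → <-irrefl (trans v≡q (sym w≡q)) v<w))
         (<-trans (middle<a 0<c) (a<high (<-trans (n<1+n m′) (n<1+n (suc m′)))))
  where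
  open FamilyB j m c
  u = suc (suc j + m′)
  v = suc (suc j + suc m′)
  w = suc (suc j + m + 0)
  2≤u : 1 < u
  2≤u = s≤s (s≤s z≤n)
  u<v : u < v
  u<v = s≤s (s≤s (+-monoʳ-< j (n<1+n m′)))
  v<w : v < w
  v<w = s≤s (s≤s (subst (j + suc m′ <_) (sym (+-identityʳ (j + m))) (+-monoʳ-< j (n<1+n (suc m′)))))
  w<n : w < suc M
  w<n = s≤s (s≤s (+-monoʳ-< (j + m) 0<c))
  v≡q : v ≡ q
  v≡q = IsCountedFun.injective (FamilyB.isCountedFun j m c) (<-trans v<w w<n) q<n
    (trans (value-high (n<1+n (suc m′))) (trans (sym (+-suc a (suc m′))) (trans a+m≡M (sym Fq≡M))))

-- At position j + 2 the run above a has started for j but not yet for j′.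
familyB-distinct : ∀ {k t j j′} → j < t → t < k → j < j′ →
  ¬ (∀ {x} → x < 3 + k → familyB j (suc k ∸ t) (t ∸ j) x ≡ familyB j′ (suc k ∸ t) (t ∸ j′) x)
familyB-distinct {k} {t} {j} {j′} j<t t<k j<j′ agree = <-irrefl (sym (suc-injective 1+a≡1+j)) (FamilyB.j<a j m (t ∸ j))
  where
  m = suc k ∸ t
  x<n : suc (suc j + 0) < 3 + k
  x<n = s≤s (s≤s (s≤s (subst (_≤ k) (sym (+-identityʳ j)) (<⇒≤ (<-trans j<t t<k)))))
  1+a≡1+j : suc (FamilyB.a j m (t ∸ j)) ≡ suc j
  1+a≡1+j = begin
    suc (FamilyB.a j m (t ∸ j))              ≡⟨ sym (+-identityʳ _) ⟩
    suc (FamilyB.a j m (t ∸ j)) + 0          ≡⟨ sym (FamilyB.value-high j m (t ∸ j) (m<n⇒0<n∸m (<-trans t<k (n<1+n k)))) ⟩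
    familyB j m (t ∸ j) (suc (suc j + 0))    ≡⟨ agree x<n ⟩
    familyB j′ m (t ∸ j′) (suc (suc j + 0))
      ≡⟨ FamilyB.value-low j′ m (t ∸ j′) (subst (_≤ j′) (sym (+-identityʳ (suc j))) j<j′) ⟩
    suc j + 0                                ≡⟨ +-identityʳ (suc j) ⟩
    suc j                                    ∎
    where open ≡-Reasoning

module _ (k : ℕ) where

  private
    _≗ₙ_ : (ℕ → ℕ) → (ℕ → ℕ) → Set
    F ≗ₙ G = ∀ {x} → x < 3 + k → F x ≡ G x

  shapeA≉shapeB : ∀ {t s t′ j} → ValidShape k (A t s) → ValidShape k (B t′ j) →
                  ¬ (shapeFun k (A t s) ≗ₙ shapeFun k (B t′ j))
  shapeA≉shapeB {t} {s} {t′} {j} (t≤k , s≤k) (j<t′ , t′<k) agree =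
    familyB-not-increasing j (suc k ∸ t′) (t′ ∸ j) 2≤m (m<n⇒0<n∸m j<t′) (familyB-max j<t′ t′<k)
      max-position<n (trans (sym (agree max-position<n)) value-at-max)
      (λ 1<x x<y y<n x≢q y≢q → subst₂ _<_ (agree (<-trans x<y y<n)) (agree y<n) (increasing 1<x x<y y<n x≢q y≢q))
    where
    open FamilyA k t s t≤k s≤k
    2≤m : 2 ≤ suc k ∸ t′
    2≤m = subst (2 ≤_) (sym (+-∸-assoc 1 (<⇒≤ t′<k))) (s≤s (m<n⇒0<n∸m t′<k))

  shapeFun-injective : ∀ {sh sh′} → ValidShape k sh → ValidShape k sh′ →
                       shapeFun k sh ≗ₙ shapeFun k sh′ → sh ≡ sh′
  shapeFun-injective {sh} {sh′} valid valid′ agree = by-shape sh sh′ valid valid′ agree first≡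
    where
    first≡ : firstEntry k sh ≡ firstEntry k sh′
    first≡ = trans (sym (shapeFun-first k sh valid)) (trans (agree (s≤s z≤n)) (shapeFun-first k sh′ valid′))

    by-shape : ∀ sh sh′ → ValidShape k sh → ValidShape k sh′ → shapeFun k sh ≗ₙ shapeFun k sh′ →
               firstEntry k sh ≡ firstEntry k sh′ → sh ≡ sh′
    by-shape (A t s) (A _ s′) (t≤k , s≤k) (_ , s′≤k) agree refl =
      cong (A t) (suc-injective (suc-injective (IsCountedFun.injective (FamilyA.isCountedFun k t s′ t≤k s′≤k)
        (FamilyA.max-position<n k t s t≤k s≤k) (FamilyA.max-position<n k t s′ t≤k s′≤k)
        (trans (sym (agree (FamilyA.max-position<n k t s t≤k s≤k)))
          (trans (FamilyA.value-at-max k t s t≤k s≤k) (sym (FamilyA.value-at-max k t s′ t≤k s′≤k)))))))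
    by-shape (A _ _) (B _ _) valid valid′ agree _ = ⊥-elim (shapeA≉shapeB valid valid′ agree)
    by-shape (B _ _) (A _ _) valid valid′ agree _ = ⊥-elim (shapeA≉shapeB valid′ valid (λ x<n → sym (agree x<n)))
    by-shape (B t j) (B _ j′) (j<t , t<k) (j′<t , _) agree refl with <-cmp j j′
    ... | tri< j<j′ _ _ = ⊥-elim (familyB-distinct j<t t<k j<j′ agree)
    ... | tri≈ _ refl _ = refl
    ... | tri> _ _ j′<j = ⊥-elim (familyB-distinct j′<t t<k j′<j (λ x<n → sym (agree x<n)))
    by-shape C C _ _ _ _ = refl
    by-shape (A t _) C (t≤k , _) _ _ 1+t≡M = ⊥-elim (<-irrefl 1+t≡M (s≤s (s≤s t≤k)))
    by-shape C (A t _) _ (t≤k , _) _ M≡1+t = ⊥-elim (<-irrefl (sym M≡1+t) (s≤s (s≤s t≤k)))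
    by-shape (B t _) C (_ , t<k) _ _ 1+t≡M = ⊥-elim (<-irrefl 1+t≡M (s≤s (s≤s (<⇒≤ t<k))))
    by-shape C (B t _) _ (_ , t<k) _ M≡1+t = ⊥-elim (<-irrefl (sym M≡1+t) (s≤s (s≤s (<⇒≤ t<k))))

-- Counting

shapesA : ℕ → List Shape
shapesA k = cartesianProductWith A (upTo (suc k)) (upTo (suc k))

shapesB : ℕ → List Shape
shapesB zero = []
shapesB (suc t) = shapesB t ++ map (B t) (upTo t)

shapes : ℕ → List Shape
shapes k = shapesA k ++ shapesB k ++ C ∷ []

∈-shapesB⁺ : ∀ {T t j} → t < T → j < t → B t j ∈ shapesB T
∈-shapesB⁺ {suc T} t<T+1 j<t with m≤n⇒m<n∨m≡n (≤-pred t<T+1)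
... | inj₁ t<T = ∈-++⁺ˡ (∈-shapesB⁺ t<T j<t)
... | inj₂ refl = ∈-++⁺ʳ (shapesB T) (∈-map⁺ (B _) (∈-upTo⁺ j<t))

∈-shapesB⁻ : ∀ {T sh} → sh ∈ shapesB T → ∃₂ λ t j → sh ≡ B t j × t < T × j < t
∈-shapesB⁻ {suc T} sh∈ with ∈-++⁻ (shapesB T) sh∈
... | inj₁ sh∈′ = let t , j , sh≡ , t<T , j<t = ∈-shapesB⁻ sh∈′ in t , j , sh≡ , <-trans t<T (n<1+n T) , j<t
... | inj₂ sh∈′ = let j , j∈ , sh≡ = ∈-map⁻ (B T) sh∈′ in T , j , sh≡ , n<1+n T , ∈-upTo⁻ j∈

∈-shapesA⁻ : ∀ {k sh} → sh ∈ shapesA k → ∃₂ λ t s → sh ≡ A t s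
∈-shapesA⁻ {k} sh∈ = let t , s , _ , _ , sh≡ = ∈-cartesianProductWith⁻ A (upTo (suc k)) (upTo (suc k)) sh∈ in t , s , sh≡

valid⇒∈shapes : ∀ {k} sh → ValidShape k sh → sh ∈ shapes k
valid⇒∈shapes (A t s) (t≤k , s≤k) = ∈-++⁺ˡ (∈-cartesianProductWith⁺ A (∈-upTo⁺ (s≤s t≤k)) (∈-upTo⁺ (s≤s s≤k)))
valid⇒∈shapes {k} (B t j) (j<t , t<k) = ∈-++⁺ʳ (shapesA k) (∈-++⁺ˡ (∈-shapesB⁺ t<k j<t))
valid⇒∈shapes {k} C _ = ∈-++⁺ʳ (shapesA k) (∈-++⁺ʳ (shapesB k) (here refl))

∈shapes⇒valid : ∀ {k sh} → sh ∈ shapes k → ValidShape k sh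
∈shapes⇒valid {k} sh∈ with ∈-++⁻ (shapesA k) sh∈
... | inj₁ sh∈A with ∈-cartesianProductWith⁻ A (upTo (suc k)) (upTo (suc k)) sh∈A
...   | _ , _ , t∈ , s∈ , refl = ≤-pred (∈-upTo⁻ t∈) , ≤-pred (∈-upTo⁻ s∈)
∈shapes⇒valid {k} sh∈ | inj₂ sh∈BC with ∈-++⁻ (shapesB k) sh∈BC
... | inj₁ sh∈B with ∈-shapesB⁻ {k} sh∈B
...   | _ , _ , refl , t<k , j<t = j<t , t<k
∈shapes⇒valid _ | inj₂ _ | inj₂ (here refl) = tt

shapesA-unique : ∀ k → Unique (shapesA k)
shapesA-unique k = Unique.cartesianProductWith⁺ A (λ { refl → refl , refl }) (Unique.upTo⁺ (suc k)) (Unique.upTo⁺ (suc k))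

shapesB-unique : ∀ T → Unique (shapesB T)
shapesB-unique zero = []
shapesB-unique (suc T) = Unique.++⁺ (shapesB-unique T) (Unique.map⁺ (λ { refl → refl }) (Unique.upTo⁺ T)) disjoint
  where
  disjoint : Disjoint (shapesB T) (map (B T) (upTo T))
  disjoint (sh∈ , sh∈′) with ∈-shapesB⁻ {T} sh∈ | ∈-map⁻ (B T) sh∈′
  ... | _ , _ , refl , T<T , _ | _ , _ , refl = <-irrefl refl T<T

shapes-unique : ∀ k → Unique (shapes k)
shapes-unique k = Unique.++⁺ (shapesA-unique k) (Unique.++⁺ (shapesB-unique k) (All.[] ∷ []) B∉C) A∉BC
  where
  B∉C : Disjoint (shapesB k) (C ∷ [])
  B∉C (sh∈ , here refl) with ∈-shapesB⁻ {k} sh∈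
  ... | _ , _ , () , _
  A∉BC : Disjoint (shapesA k) (shapesB k ++ C ∷ [])
  A∉BC (sh∈ , sh∈′) with ∈-shapesA⁻ {k} sh∈ | ∈-++⁻ (shapesB k) sh∈′
  ... | _ , _ , refl | inj₁ sh∈B with ∈-shapesB⁻ {k} sh∈B
  ...   | _ , _ , () , _
  A∉BC (sh∈ , sh∈′) | _ , _ , refl | inj₂ (here ())

length-shapesA : ∀ k → length (shapesA k) ≡ suc k * suc k
length-shapesA k = trans (length-cartesianProductWith A (upTo (suc k)) (upTo (suc k)))
  (cong₂ _*_ (length-upTo (suc k)) (length-upTo (suc k)))

length-shapesB : ∀ T → 2 * length (shapesB T) + T ≡ T * T
length-shapesB zero = refl
length-shapesB (suc T) = begin
  2 * length (shapesB T ++ map (B T) (upTo T)) + suc T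
    ≡⟨ cong (λ L → 2 * L + suc T) (trans (length-++ (shapesB T))
         (cong (length (shapesB T) +_) (trans (length-map (B T) (upTo T)) (length-upTo T)))) ⟩
  2 * (length (shapesB T) + T) + suc T  ≡⟨ regroup (length (shapesB T)) T ⟩
  (2 * length (shapesB T) + T) + (2 * T + 1)  ≡⟨ cong (_+ (2 * T + 1)) (length-shapesB T) ⟩
  T * T + (2 * T + 1)  ≡⟨ square-suc T ⟩
  suc T * suc T  ∎
  where
  open ≡-Reasoning
  regroup : ∀ L T → 2 * (L + T) + suc T ≡ (2 * L + T) + (2 * T + 1)
  regroup = solve-∀
  square-suc : ∀ T → T * T + (2 * T + 1) ≡ suc T * suc T
  square-suc = solve-∀

length-shapes : ∀ k → 2 * length (shapes k) + 15 * (3 + k) ≡ 3 * ((3 + k) * (3 + k)) + 22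
length-shapes k = +-cancelʳ-≡ k _ _ (begin
  2 * length (shapes k) + 15 * (3 + k) + k
    ≡⟨ cong (λ L → 2 * L + 15 * (3 + k) + k)
         (trans (length-++ (shapesA k)) (cong₂ _+_ (length-shapesA k) (length-++ (shapesB k)))) ⟩
  2 * (suc k * suc k + (length (shapesB k) + 1)) + 15 * (3 + k) + k  ≡⟨ expand k (length (shapesB k)) ⟩
  (2 * length (shapesB k) + k) + (2 * (suc k * suc k) + 2 + 15 * (3 + k))
    ≡⟨ cong (_+ (2 * (suc k * suc k) + 2 + 15 * (3 + k))) (length-shapesB k) ⟩
  k * k + (2 * (suc k * suc k) + 2 + 15 * (3 + k))  ≡⟨ collect k ⟩
  3 * ((3 + k) * (3 + k)) + 22 + k  ∎)
  where
  open ≡-Reasoning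
  expand : ∀ k L → 2 * (suc k * suc k + (L + 1)) + 15 * (3 + k) + k ≡
                   (2 * L + k) + (2 * (suc k * suc k) + 2 + 15 * (3 + k))
  expand = solve-∀
  collect : ∀ k → k * k + (2 * (suc k * suc k) + 2 + 15 * (3 + k)) ≡ 3 * ((3 + k) * (3 + k)) + 22 + k
  collect = solve-∀

module _ (k : ℕ) where

  shapeWord : Shape → Word (3 + k)
  shapeWord sh = wordOf (shapeFun k sh)

  countedWords : List (Word (3 + k))
  countedWords = map shapeWord (shapes k)

  shapeWord-injective : ∀ {sh sh′} → sh ∈ shapes k → sh′ ∈ shapes k → shapeWord sh ≡ shapeWord sh′ → sh ≡ sh′
  shapeWord-injective {sh} {sh′} sh∈ sh′∈ W≡W′ = shapeFun-injective k valid valid′ λ {x} x<n → begin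
    shapeFun k sh x               ≡⟨ sym (valueAt-wordOf (IsCountedFun.bounded (shapeFun-isCountedFun k sh valid)) x<n) ⟩
    valueAt (shapeWord sh) x      ≡⟨ cong (λ π → valueAt π x) W≡W′ ⟩
    valueAt (shapeWord sh′) x     ≡⟨ valueAt-wordOf (IsCountedFun.bounded (shapeFun-isCountedFun k sh′ valid′)) x<n ⟩
    shapeFun k sh′ x              ∎
    where
    open ≡-Reasoning
    valid = ∈shapes⇒valid sh∈
    valid′ = ∈shapes⇒valid sh′∈

  countedWords-complete : ∀ π → (π ∈ countedWords → Counted π) × (Counted π → π ∈ countedWords)
  countedWords-complete π = sound , complete
    where
    sound : π ∈ countedWords → Counted π
    sound π∈ with ∈-map⁻ shapeWord π∈
    ... | sh , sh∈ , π≡W = subst Counted (sym π≡W)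
            (isCountedFun⇒counted (shapeFun k sh) (shapeFun-isCountedFun k sh (∈shapes⇒valid sh∈)))
    complete : Counted π → π ∈ countedWords
    complete counted with Classification.classify k (counted⇒isCountedFun π counted)
    ... | sh , valid , agree = subst (_∈ countedWords) (sym (wordOf-valueAt π (shapeFun k sh) agree))
                                 (∈-map⁺ shapeWord (valid⇒∈shapes sh valid))

proposition2p8 : (k : ℕ) → Σ ℕ λ c →
    HasCount (Counted {suc k}) c ×
    (2 * c + 15 * (3 + k) ≡ 3 * ((3 + k) * (3 + k)) + 22)
proposition2p8 k = length (shapes k) ,
  ( countedWords k
  , map⁺-injectiveOn (shapeWord k) (shapeWord-injective k) (shapes-unique k)
  , countedWords-complete k
  , length-map (shapeWord k) (shapes k) ) ,
  length-shapes k
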